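{- Let $G=(\Gamma,R,B)$ be a $2$-edge-coloured graph on $n$ vertices with $\chi(G)=n$. Then \[P(G\cup K_2^r,\lambda)=\lambda(\lambda-1)\cdots(\lambda-n+1)\left(\lambda^2-\lambda-2|B|\right).\]
   Context: All graphs are finite and simple. A $2$-edge-coloured graph is a triple $G=(\Gamma,R,B)$ with $R,B\subseteq E(\Gamma)$, $R\cap B=\emptyset$, $R\cup B=E(\Gamma)$ (red and blue edges). A $k$-colouring of $G$ is a proper vertex colouring $c:V(\Gamma)\to\{1,\dots,k\}$ of $\Gamma$ such that for every $ux\in R$ and $vy\in B$ (either endpoint may play the role of $u$, resp. $v$), $c(u)=c(v)$ implies $c(x)\ne c(y)$. $\chi(G)$ is the least $k$ for which $G$ has a $k$-colouring, and $P(G,\lambda)$ is the polynomial whose value at each non-negative integer $k$ is the number of $k$-colourings of $G$. $K_2^r$ is the $2$-edge-coloured graph consisting of a single red edge, and $G\cup H$ denotes the disjoint union of $2$-edge-coloured graphs (edges keep their colours). -}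

module Defs where

open import Data.Bool using (Bool; true; false; T; _∨_)
open import Data.Bool.Properties using (T?)
open import Data.Nat using (ℕ; zero; suc; _+_; _<_)
import Data.Nat as ℕ
open import Data.Fin using (Fin; splitAt; toℕ; _≟_)
open import Data.Fin.Properties using (all?)
open import Data.Sum using (inj₁; inj₂)
open import Data.Product using (Σ; _×_; _,_)
open import Data.Vec using (Vec; []; _∷_; lookup)
open import Data.List using (List; []; _∷_; length; filter; concatMap; map; allFin)
open import Data.Integer using (ℤ; +_; _-_; _*_)
open import Relation.Binary.PropositionalEquality using (_≡_; _≢_)
open import Relation.Nullary using (¬_; Dec)
open import Relation.Nullary.Decidable using (_→-dec_; ¬?; _×-dec_)

record ECGraph (n : ℕ) : Set where
  field
    red  : Fin n → Fin n → Bool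
    blue : Fin n → Fin n → Bool
open ECGraph public

-- Well-formedness: simple graph (symmetric, loopless), R ∩ B = ∅.
-- (E(Γ) is then R ∪ B by definition.)
record WellFormed {n : ℕ} (G : ECGraph n) : Set where
  field
    red-sym   : ∀ i j → red G i j ≡ red G j i
    blue-sym  : ∀ i j → blue G i j ≡ blue G j i
    red-irr   : ∀ i → red G i i ≡ false
    blue-irr  : ∀ i → blue G i i ≡ false
    disjoint  : ∀ i j → T (red G i j) → ¬ T (blue G i j)

edge : ∀ {n} → ECGraph n → Fin n → Fin n → Bool
edge G i j = red G i j ∨ blue G i j

IsColouring : ∀ {n k} → ECGraph n → Vec (Fin k) n → Set
IsColouring {n} G c =
  (∀ (u x : Fin n) → T (edge G u x) → lookup c u ≢ lookup c x)
  × (∀ (u x v y : Fin n) → T (red G u x) → T (blue G v y) →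
       lookup c u ≡ lookup c v → lookup c x ≢ lookup c y)

isColouring? : ∀ {n k} (G : ECGraph n) (c : Vec (Fin k) n) → Dec (IsColouring G c)
isColouring? G c =
  all? (λ u → all? (λ x → T? (edge G u x) →-dec ¬? (lookup c u ≟ lookup c x)))
  ×-dec
  all? (λ u → all? (λ x → all? (λ v → all? (λ y →
    T? (red G u x) →-dec (T? (blue G v y) →-dec
      ((lookup c u ≟ lookup c v) →-dec ¬? (lookup c x ≟ lookup c y)))))))

Colourable : ∀ {n} → ECGraph n → ℕ → Set
Colourable {n} G k = Σ (Vec (Fin k) n) (IsColouring G)

ChromaticNumberIs : ∀ {n} → ECGraph n → ℕ → Set
ChromaticNumberIs G m = Colourable G m × (∀ k → k < m → ¬ Colourable G k)

allVecs : ∀ n k → List (Vec (Fin k) n)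
allVecs zero    k = [] ∷ []
allVecs (suc n) k = concatMap (λ a → map (a ∷_) (allVecs n k)) (allFin k)

numColourings : ∀ {n} → ECGraph n → ℕ → ℕ
numColourings {n} G k = length (filter (isColouring? G) (allVecs n k))

-- |B| : number of blue edges (unordered pairs {i,j}, counted once via toℕ i < toℕ j)
numBlue : ∀ {n} → ECGraph n → ℕ
numBlue {n} G = length (filter (λ p → (toℕ (Data.Product.proj₁ p) ℕ.<? toℕ (Data.Product.proj₂ p))
                                      ×-dec T? (blue G (Data.Product.proj₁ p) (Data.Product.proj₂ p)))
                               (Data.List.cartesianProduct (allFin n) (allFin n)))

-- disjoint union: vertices of G are Fin m, those of H follow as Fin n (in Fin (m + n))
_∪_ : ∀ {m n} → ECGraph m → ECGraph n → ECGraph (m + n)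
_∪_ {m} {n} G H = record { red = lift (red G) (red H) ; blue = lift (blue G) (blue H) }
  where
  lift : (Fin m → Fin m → Bool) → (Fin n → Fin n → Bool) → Fin (m + n) → Fin (m + n) → Bool
  lift f g i j with splitAt m i | splitAt m j
  ... | inj₁ a | inj₁ b = f a b
  ... | inj₂ a | inj₂ b = g a b
  ... | inj₁ _ | inj₂ _ = false
  ... | inj₂ _ | inj₁ _ = false

K2r : ECGraph 2
K2r = record { red = λ i j → not-eq i j ; blue = λ _ _ → false }
  where
  not-eq : Fin 2 → Fin 2 → Bool
  not-eq Fin.zero Fin.zero = false
  not-eq (Fin.suc Fin.zero) (Fin.suc Fin.zero) = false
  not-eq _ _ = true

falling : ℤ → ℕ → ℤ
falling x zero    = + 1
falling x (suc n) = falling x n * (x - + n)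

module Submission where

-- (1) Every colouring of G is injective, since merging two vertices of equal colour would
--     colour G with n - 1 colours; conversely, as G is simple with R ∩ B = ∅, every injective
--     assignment of colours is a colouring. Hence G has k (k - 1) ⋯ (k - n + 1) k-colourings.
-- (2) A colouring of a disjoint union is a colouring of each part such that red edges of one
--     part are compatible with blue edges of the other. For G ∪ K₂ʳ: a colouring c of G extends
--     by colours (α, β) on the red edge iff α ≢ β and no blue edge vy has (c v, c y) = (α, β).
-- (3) For injective c the pairs (α, β) excluded by the second condition correspond to the 2|B|
--     ordered blue pairs (v, y), so c has exactly k² - k - 2|B| extensions; summing over c gives
--     the theorem.

module FiniteSums where

  open import Data.Nat using (ℕ; zero; suc; _+_; _*_)
  open import Data.Nat.Properties using (+-assoc; +-identityʳ; *-zeroʳ; *-identityʳ; *-distribˡ-+; +-commutativeSemigroup)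
  open import Algebra.Properties.CommutativeSemigroup +-commutativeSemigroup using (interchange)
  open import Data.Fin using (Fin; zero; suc; _≟_)
  open import Data.Fin.Properties using (any?; suc-injective)
  open import Data.List using (List; []; _∷_; length; filter; concatMap; concat; map; allFin; tabulate; _++_; cartesianProduct)
  open import Data.List.Properties using (length-tabulate; map-tabulate)
  open import Data.Product using (_×_; _,_)
  open import Data.Sum using (_⊎_; inj₁; inj₂)
  open import Function using (_∘_; id)
  open import Function.Definitions using (Injective)
  open import Relation.Binary.PropositionalEquality
  open import Relation.Nullary using (¬_; Dec; yes; no; contradiction)
  open import Relation.Nullary.Decidable using (¬?; _×-dec_; _⊎-dec_)
  open import Relation.Unary using (Decidable)

  sumOver : ∀ {a} {A : Set a} → List A → (A → ℕ) → ℕ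
  sumOver []       f = 0
  sumOver (x ∷ xs) f = f x + sumOver xs f

  syntax sumOver L (λ x → e) = ∑[ x ← L ] e

  𝟙 : ∀ {p} {P : Set p} → Dec P → ℕ
  𝟙 (yes _) = 1
  𝟙 (no _)  = 0

  𝟙-yes : ∀ {p} {P : Set p} (a : Dec P) → P → 𝟙 a ≡ 1
  𝟙-yes (yes _) _  = refl
  𝟙-yes (no ¬p) p = contradiction p ¬p

  𝟙-no : ∀ {p} {P : Set p} (a : Dec P) → ¬ P → 𝟙 a ≡ 0
  𝟙-no (yes p) ¬p = contradiction p ¬p
  𝟙-no (no _)  _  = refl

  𝟙-¬ : ∀ {p} {P : Set p} (a : Dec P) → 𝟙 (¬? a) + 𝟙 a ≡ 1
  𝟙-¬ (yes _) = refl
  𝟙-¬ (no _)  = refl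

  module _ {p q} {P : Set p} {Q : Set q} where

    𝟙-cong : (a : Dec P) (b : Dec Q) → (P → Q) → (Q → P) → 𝟙 a ≡ 𝟙 b
    𝟙-cong (yes p) b       f g = sym (𝟙-yes b (f p))
    𝟙-cong (no ¬p) (yes q) f g = contradiction (g q) ¬p
    𝟙-cong (no _)  (no _)  f g = refl

    𝟙-× : (a : Dec P) (b : Dec Q) → 𝟙 (a ×-dec b) ≡ 𝟙 a * 𝟙 b
    𝟙-× (yes _) (yes _) = refl
    𝟙-× (yes _) (no _)  = refl
    𝟙-× (no _)  _       = refl

    𝟙-⊎ : (a : Dec P) (b : Dec Q) → ¬ (P × Q) → 𝟙 (a ⊎-dec b) ≡ 𝟙 a + 𝟙 b
    𝟙-⊎ (yes p) (yes q) disjoint = contradiction (p , q) disjoint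
    𝟙-⊎ (yes _) (no _)  _        = refl
    𝟙-⊎ (no _)  (yes _) _        = refl
    𝟙-⊎ (no _)  (no _)  _        = refl

  𝟙-split : ∀ {b l₁ l₂} {B : Set b} {L₁ : Set l₁} {L₂ : Set l₂} (d : Dec B) (d₁ : Dec L₁) (d₂ : Dec L₂) →
    ¬ (L₁ × L₂) → (B → L₁ ⊎ L₂) → 𝟙 d ≡ 𝟙 (d₁ ×-dec d) + 𝟙 (d₂ ×-dec d)
  𝟙-split d d₁ d₂ exclusive alternatives = trans
    (𝟙-cong d ((d₁ ×-dec d) ⊎-dec (d₂ ×-dec d))
      (λ b → case-⊎ (alternatives b) b) (λ { (inj₁ (_ , b)) → b ; (inj₂ (_ , b)) → b }))
    (𝟙-⊎ (d₁ ×-dec d) (d₂ ×-dec d) (λ ((l₁ , _) , (l₂ , _)) → exclusive (l₁ , l₂)))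
    where
    case-⊎ : ∀ {l₁ l₂} {L₁ : Set l₁} {L₂ : Set l₂} {B : Set _} → L₁ ⊎ L₂ → B → (L₁ × B) ⊎ (L₂ × B)
    case-⊎ (inj₁ l₁) b = inj₁ (l₁ , b)
    case-⊎ (inj₂ l₂) b = inj₂ (l₂ , b)

  length-filter≡∑𝟙 : ∀ {a p} {A : Set a} {P : A → Set p} (P? : Decidable P) (xs : List A) →
    length (filter P? xs) ≡ ∑[ x ← xs ] 𝟙 (P? x)
  length-filter≡∑𝟙 P? []       = refl
  length-filter≡∑𝟙 P? (x ∷ xs) with P? x
  ... | yes _ = cong suc (length-filter≡∑𝟙 P? xs)
  ... | no _  = length-filter≡∑𝟙 P? xs

  module _ {a} {A : Set a} where

    ∑-cong : ∀ (L : List A) {f g : A → ℕ} → (∀ x → f x ≡ g x) → sumOver L f ≡ sumOver L g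
    ∑-cong []      eq = refl
    ∑-cong (x ∷ L) eq = cong₂ _+_ (eq x) (∑-cong L eq)

    ∑-const : ∀ (L : List A) c → ∑[ _ ← L ] c ≡ length L * c
    ∑-const []      c = refl
    ∑-const (x ∷ L) c = cong (c +_) (∑-const L c)

    ∑-+ : ∀ (L : List A) (f g : A → ℕ) → ∑[ x ← L ] (f x + g x) ≡ sumOver L f + sumOver L g
    ∑-+ []      f g = refl
    ∑-+ (x ∷ L) f g = begin
      f x + g x + ∑[ x ← L ] (f x + g x)      ≡⟨ cong (f x + g x +_) (∑-+ L f g) ⟩
      f x + g x + (sumOver L f + sumOver L g) ≡⟨ interchange (f x) (g x) (sumOver L f) (sumOver L g) ⟩
      f x + sumOver L f + (g x + sumOver L g) ∎
      where open ≡-Reasoning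

    ∑-zero : ∀ (L : List A) (f : A → ℕ) → (∀ x → f x ≡ 0) → sumOver L f ≡ 0
    ∑-zero L f eq = trans (∑-cong L eq) (trans (∑-const L 0) (*-zeroʳ (length L)))

    ∑-*ˡ : ∀ (L : List A) c (f : A → ℕ) → ∑[ x ← L ] (c * f x) ≡ c * sumOver L f
    ∑-*ˡ []      c f = sym (*-zeroʳ c)
    ∑-*ˡ (x ∷ L) c f = trans (cong (c * f x +_) (∑-*ˡ L c f)) (sym (*-distribˡ-+ c (f x) (sumOver L f)))

    ∑-++ : ∀ (L M : List A) f → sumOver (L ++ M) f ≡ sumOver L f + sumOver M f
    ∑-++ []      M f = refl
    ∑-++ (x ∷ L) M f = trans (cong (f x +_) (∑-++ L M f)) (sym (+-assoc (f x) (sumOver L f) (sumOver M f)))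

  module _ {a b} {A : Set a} {B : Set b} where

    ∑-map : ∀ (L : List A) (h : A → B) f → sumOver (map h L) f ≡ sumOver L (f ∘ h)
    ∑-map []      h f = refl
    ∑-map (x ∷ L) h f = cong (f (h x) +_) (∑-map L h f)

    ∑-concatMap : ∀ (L : List A) (h : A → List B) f →
      sumOver (concatMap h L) f ≡ ∑[ x ← L ] sumOver (h x) f
    ∑-concatMap []      h f = refl
    ∑-concatMap (x ∷ L) h f =
      trans (∑-++ (h x) (concat (map h L)) f) (cong (sumOver (h x) f +_) (∑-concatMap L h f))

    ∑-swap : ∀ (L : List A) (M : List B) (f : A → B → ℕ) →
      ∑[ x ← L ] ∑[ y ← M ] f x y ≡ ∑[ y ← M ] ∑[ x ← L ] f x y
    ∑-swap []      M f = sym (∑-zero M _ (λ _ → refl))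
    ∑-swap (x ∷ L) M f =
      trans (cong (sumOver M (f x) +_) (∑-swap L M f)) (sym (∑-+ M (f x) (λ y → ∑[ x ← L ] f x y)))

  ∑-cartesianProduct : ∀ {a b} {A : Set a} {B : Set b} (L : List A) (M : List B) (f : A × B → ℕ) →
    sumOver (cartesianProduct L M) f ≡ ∑[ x ← L ] ∑[ y ← M ] f (x , y)
  ∑-cartesianProduct []      M f = refl
  ∑-cartesianProduct (x ∷ L) M f =
    trans (∑-++ (map (x ,_) M) (cartesianProduct L M) f) (cong₂ _+_ (∑-map M (x ,_) f) (∑-cartesianProduct L M f))

  ∑-allFin-suc : ∀ n (f : Fin (suc n) → ℕ) → sumOver (allFin (suc n)) f ≡ f zero + ∑[ v ← allFin n ] f (suc v)
  ∑-allFin-suc n f = cong (f zero +_) (begin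
    sumOver (tabulate suc) f          ≡⟨ cong (λ L → sumOver L f) (sym (map-tabulate id suc)) ⟩
    sumOver (map suc (allFin n)) f    ≡⟨ ∑-map (allFin n) suc f ⟩
    ∑[ v ← allFin n ] f (suc v)       ∎)
    where open ≡-Reasoning

  ∑-allFin-const : ∀ k c → ∑[ _ ← allFin k ] c ≡ k * c
  ∑-allFin-const k c = trans (∑-const (allFin k) c) (cong (_* c) (length-tabulate {n = k} id))

  ∑-point : ∀ m (v₀ : Fin m) (h : Fin m → ℕ) → ∑[ v ← allFin m ] (𝟙 (v ≟ v₀) * h v) ≡ h v₀
  ∑-point (suc m) zero h = begin
    sumOver (allFin (suc m)) (λ v → 𝟙 (v ≟ zero) * h v)        ≡⟨ ∑-allFin-suc m (λ v → 𝟙 (v ≟ zero) * h v) ⟩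
    h zero + 0 + ∑[ v ← allFin m ] (𝟙 (suc v ≟ zero) * h (suc v))
      ≡⟨ cong (h zero + 0 +_) (∑-zero (allFin m) _ (λ v → cong (_* h (suc v)) (𝟙-no (suc v ≟ zero) λ ()))) ⟩
    h zero + 0 + 0                                               ≡⟨ trans (+-identityʳ _) (+-identityʳ _) ⟩
    h zero                                                       ∎
    where open ≡-Reasoning
  ∑-point (suc m) (suc w) h = begin
    sumOver (allFin (suc m)) (λ v → 𝟙 (v ≟ suc w) * h v)       ≡⟨ ∑-allFin-suc m (λ v → 𝟙 (v ≟ suc w) * h v) ⟩
    0 + ∑[ v ← allFin m ] (𝟙 (suc v ≟ suc w) * h (suc v))
      ≡⟨ ∑-cong (allFin m) (λ v → cong (_* h (suc v)) (𝟙-cong (suc v ≟ suc w) (v ≟ w) suc-injective (cong suc))) ⟩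
    ∑[ v ← allFin m ] (𝟙 (v ≟ w) * h (suc v))                   ≡⟨ ∑-point m w (h ∘ suc) ⟩
    h (suc w)                                                    ∎
    where open ≡-Reasoning

  ∑-unique : ∀ {p} m (v₀ : Fin m) {P : Fin m → Set p} (P? : Decidable P) →
    (∀ v → P v → v ≡ v₀) → P v₀ → (h : Fin m → ℕ) → ∑[ v ← allFin m ] (𝟙 (P? v) * h v) ≡ h v₀
  ∑-unique m v₀ P? only-v₀ Pv₀ h = trans
    (∑-cong (allFin m) (λ v → cong (_* h v) (𝟙-cong (P? v) (v ≟ v₀) (only-v₀ v) (λ { refl → Pv₀ }))))
    (∑-point m v₀ h)

  ∑-diagonal : ∀ k → ∑[ α ← allFin k ] ∑[ β ← allFin k ] 𝟙 (α ≟ β) ≡ k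
  ∑-diagonal k = begin
    ∑[ α ← allFin k ] ∑[ β ← allFin k ] 𝟙 (α ≟ β)
      ≡⟨ ∑-cong (allFin k) (λ α → ∑-cong (allFin k) (λ β → sym (*-identityʳ (𝟙 (α ≟ β))))) ⟩
    ∑[ α ← allFin k ] ∑[ β ← allFin k ] (𝟙 (α ≟ β) * 1)
      ≡⟨ ∑-cong (allFin k) (λ α → ∑-unique k α (α ≟_) (λ _ α≡β → sym α≡β) refl (λ _ → 1)) ⟩
    ∑[ α ← allFin k ] 1                                   ≡⟨ ∑-allFin-const k 1 ⟩
    k * 1                                                 ≡⟨ *-identityʳ k ⟩
    k                                                     ∎
    where open ≡-Reasoning

  ∑-reindex : ∀ n k (c : Fin n → Fin k) → Injective _≡_ _≡_ c →
    (F : Fin k → ℕ) (H : Fin n → ℕ) → (∀ v → F (c v) ≡ H v) → (∀ α → (∀ v → c v ≢ α) → F α ≡ 0) →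
    sumOver (allFin k) F ≡ sumOver (allFin n) H
  ∑-reindex n k c c-inj F H F∘c≡H F-off-image = begin
    sumOver (allFin k) F                                       ≡⟨ ∑-cong (allFin k) F-as-sum ⟩
    ∑[ α ← allFin k ] ∑[ v ← allFin n ] (𝟙 (c v ≟ α) * H v)   ≡⟨ ∑-swap (allFin k) (allFin n) _ ⟩
    ∑[ v ← allFin n ] ∑[ α ← allFin k ] (𝟙 (c v ≟ α) * H v)
      ≡⟨ ∑-cong (allFin n) (λ v → ∑-unique k (c v) (c v ≟_) (λ _ e → sym e) refl (λ _ → H v)) ⟩
    sumOver (allFin n) H                                       ∎
    where
    open ≡-Reasoning
    F-as-sum : ∀ α → F α ≡ ∑[ v ← allFin n ] (𝟙 (c v ≟ α) * H v)
    F-as-sum α with any? (λ v → c v ≟ α)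
    ... | yes (v₀ , refl) = sym (trans (∑-unique n v₀ (λ v → c v ≟ c v₀) (λ v → c-inj) refl H) (sym (F∘c≡H v₀)))
    ... | no ∉image = trans (F-off-image α (λ v e → ∉image (v , e)))
      (sym (∑-zero (allFin n) _ (λ v → cong (_* H v) (𝟙-no (c v ≟ α) (λ e → ∉image (v , e))))))

module Colourings where

  open import Defs
  open import Data.Bool using (T)
  open import Data.Nat using (ℕ; suc)
  open import Data.Nat.Properties using (n<1+n)
  open import Data.Empty using (⊥; ⊥-elim)
  open import Data.Fin using (Fin; _≟_; punchOut)
  open import Data.Fin.Properties using (punchOut-injective)
  open import Data.Vec using (Vec; lookup; tabulate)
  open import Data.Vec.Properties using (lookup∘tabulate)
  open import Data.Product using (Σ; _,_)
  open import Function.Definitions using (Injective)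
  open import Relation.Binary.PropositionalEquality
  open import Relation.Nullary using (yes; no)

  module _ {n : ℕ} (G : ECGraph n) where

    -- Being a colouring only depends on which vertices share a colour: a recolouring d
    -- that identifies no two vertices separated by c is again a colouring.
    colouring-refine : ∀ {k k′} (c : Vec (Fin k) n) (d : Vec (Fin k′) n) → IsColouring G c →
      (∀ u v → lookup d u ≡ lookup d v → lookup c u ≡ lookup c v) → IsColouring G d
    colouring-refine c d (proper , red-blue) d⇒c =
      (λ u x e eq → proper u x e (d⇒c u x eq)) ,
      (λ u x v y r b eq₁ eq₂ → red-blue u x v y r b (d⇒c u v eq₁) (d⇒c x y eq₂))

    -- In a well-formed graph every injective assignment of colours is a colouring:
    -- edges are loopless, and a red and a blue edge never join the same pair.
    injective⇒colouring : WellFormed G → ∀ {k} (c : Vec (Fin k) n) → Injective _≡_ _≡_ (lookup c) →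
      IsColouring G c
    injective⇒colouring wf c c-inj = (λ u x e eq → loopless u x e (c-inj eq)) ,
      (λ u x v y r b eq₁ eq₂ → red≢blue u x v y r b (c-inj eq₁) (c-inj eq₂))
      where
      open WellFormed wf
      loopless : ∀ u x → T (edge G u x) → u ≢ x
      loopless u .u e refl rewrite red-irr u | blue-irr u = e
      red≢blue : ∀ u x v y → T (red G u x) → T (blue G v y) → u ≡ v → x ≡ y → ⊥
      red≢blue u x .u .x r b refl refl = disjoint u x r b

  -- Two vertices i ≢ j of the same colour can be merged: then suc m vertices need only
  -- m colours. Send the colour class of i onto j, which frees the index i, and punch it out.
  merge-colour : ∀ {m k} (c : Vec (Fin k) (suc m)) {i j : Fin (suc m)} → i ≢ j → lookup c i ≡ lookup c j →
    Σ (Vec (Fin m) (suc m)) λ d → ∀ u v → lookup d u ≡ lookup d v → lookup c u ≡ lookup c v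
  merge-colour c {i} {j} i≢j ci≡cj = tabulate merged , d⇒c
    where
    g : Fin _ → Fin _
    g v with lookup c v ≟ lookup c i
    ... | yes _ = j
    ... | no _  = v

    i≢g : ∀ v → i ≢ g v
    i≢g v with lookup c v ≟ lookup c i
    ... | yes _     = i≢j
    ... | no cv≢ci = λ i≡v → cv≢ci (cong (lookup c) (sym i≡v))

    g-keeps-colour : ∀ v → lookup c (g v) ≡ lookup c v
    g-keeps-colour v with lookup c v ≟ lookup c i
    ... | yes cv≡ci = trans (sym ci≡cj) (sym cv≡ci)
    ... | no _      = refl

    merged : Fin (suc _) → Fin _
    merged v = punchOut (i≢g v)

    d⇒c : ∀ u v → lookup (tabulate merged) u ≡ lookup (tabulate merged) v → lookup c u ≡ lookup c v
    d⇒c u v eq = begin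
      lookup c u       ≡⟨ sym (g-keeps-colour u) ⟩
      lookup c (g u)   ≡⟨ cong (lookup c) (punchOut-injective (i≢g u) (i≢g v) punched) ⟩
      lookup c (g v)   ≡⟨ g-keeps-colour v ⟩
      lookup c v       ∎
      where
      open ≡-Reasoning
      punched : merged u ≡ merged v
      punched = trans (sym (lookup∘tabulate merged u)) (trans eq (lookup∘tabulate merged v))

  -- If χ(G) equals the number of vertices, every colouring of G is injective:
  -- otherwise merging a repeated colour would colour G with one colour fewer.
  full-chromatic⇒injective : ∀ {n} (G : ECGraph n) → ChromaticNumberIs G n →
    ∀ {k} (c : Vec (Fin k) n) → IsColouring G c → Injective _≡_ _≡_ (lookup c)
  full-chromatic⇒injective {suc m} G (_ , minimal) c col {i} {j} ci≡cj with i ≟ j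
  ... | yes i≡j = i≡j
  ... | no i≢j  = ⊥-elim (minimal m (n<1+n m) (d , colouring-refine G c d col d⇒c))
    where
    open Σ (merge-colour c i≢j ci≡cj) renaming (proj₁ to d; proj₂ to d⇒c)

module DisjointUnion where

  open import Defs
  open import Data.Bool using (Bool; T; _∨_)
  open import Data.Bool.Properties using (T-∨)
  open import Data.Empty using (⊥-elim)
  open import Data.Nat using (ℕ; _+_)
  open import Data.Fin using (Fin; zero; suc; splitAt; _↑ˡ_; _↑ʳ_)
  open import Data.Fin.Properties using (splitAt-↑ˡ; splitAt-↑ʳ; splitAt⁻¹-↑ˡ; splitAt⁻¹-↑ʳ)
  open import Data.Vec using (Vec; []; _∷_; lookup; _++_)
  open import Data.Vec.Properties using (lookup-++ˡ; lookup-++ʳ)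
  open import Data.Product using (Σ; _×_; _,_)
  open import Data.Sum using (_⊎_; inj₁; inj₂)
  open import Function.Bundles using (_⇔_; mk⇔; Equivalence)
  open import Relation.Binary.PropositionalEquality
  open import Relation.Nullary using (¬_)

  -- IsColouring G c unfolds to
  -- Proper G (lookup c) × RedBlueCompatible G G (lookup c) (lookup c).
  Proper : ∀ {m k} → ECGraph m → (Fin m → Fin k) → Set
  Proper {m} G c = ∀ (u x : Fin m) → T (edge G u x) → c u ≢ c x

  RedBlueCompatible : ∀ {m p k} → ECGraph m → ECGraph p → (Fin m → Fin k) → (Fin p → Fin k) → Set
  RedBlueCompatible {m} {p} G H c d = ∀ (u x : Fin m) (v y : Fin p) → T (red G u x) → T (blue H v y) →
    c u ≡ d v → c x ≢ d y

  proper-pullback : ∀ {m m′ k} (G : ECGraph m) (G′ : ECGraph m′) {c : Fin m → Fin k} {c′ : Fin m′ → Fin k}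
    (ι : Fin m → Fin m′) → (∀ a → c′ (ι a) ≡ c a) → (∀ a b → T (edge G a b) → T (edge G′ (ι a) (ι b))) →
    Proper G′ c′ → Proper G c
  proper-pullback G G′ ι colour-ι edge-ι proper′ u x e eq =
    proper′ (ι u) (ι x) (edge-ι u x e) (subst₂ _≡_ (sym (colour-ι u)) (sym (colour-ι x)) eq)

  compatible-pullback : ∀ {m m′ p p′ k} (G : ECGraph m) (G′ : ECGraph m′) (H : ECGraph p) (H′ : ECGraph p′)
    {c : Fin m → Fin k} {c′ : Fin m′ → Fin k} {d : Fin p → Fin k} {d′ : Fin p′ → Fin k}
    (ι : Fin m → Fin m′) → (∀ a → c′ (ι a) ≡ c a) → (κ : Fin p → Fin p′) → (∀ a → d′ (κ a) ≡ d a) →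
    (∀ a b → T (red G a b) → T (red G′ (ι a) (ι b))) → (∀ a b → T (blue H a b) → T (blue H′ (κ a) (κ b))) →
    RedBlueCompatible G′ H′ c′ d′ → RedBlueCompatible G H c d
  compatible-pullback G G′ H H′ ι colour-ι κ colour-κ red-ι blue-κ compatible′ u x v y r b eq₁ eq₂ =
    compatible′ (ι u) (ι x) (κ v) (κ y) (red-ι u x r) (blue-κ v y b)
      (subst₂ _≡_ (sym (colour-ι u)) (sym (colour-κ v)) eq₁)
      (subst₂ _≡_ (sym (colour-ι x)) (sym (colour-κ y)) eq₂)

  data Within {m p : ℕ} (f : Fin m → Fin m → Bool) (g : Fin p → Fin p → Bool) : Fin (m + p) → Fin (m + p) → Set where
    left  : ∀ {a b} → T (f a b) → Within f g (a ↑ˡ p) (b ↑ˡ p)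
    right : ∀ {a b} → T (g a b) → Within f g (m ↑ʳ a) (m ↑ʳ b)

  module _ {m p : ℕ} (G : ECGraph m) (H : ECGraph p) where

    red-↑ˡ : ∀ a b → red (G ∪ H) (a ↑ˡ p) (b ↑ˡ p) ≡ red G a b
    red-↑ˡ a b rewrite splitAt-↑ˡ m a p | splitAt-↑ˡ m b p = refl

    blue-↑ˡ : ∀ a b → blue (G ∪ H) (a ↑ˡ p) (b ↑ˡ p) ≡ blue G a b
    blue-↑ˡ a b rewrite splitAt-↑ˡ m a p | splitAt-↑ˡ m b p = refl

    red-↑ʳ : ∀ a b → red (G ∪ H) (m ↑ʳ a) (m ↑ʳ b) ≡ red H a b
    red-↑ʳ a b rewrite splitAt-↑ʳ m p a | splitAt-↑ʳ m p b = refl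

    blue-↑ʳ : ∀ a b → blue (G ∪ H) (m ↑ʳ a) (m ↑ʳ b) ≡ blue H a b
    blue-↑ʳ a b rewrite splitAt-↑ʳ m p a | splitAt-↑ʳ m p b = refl

    red-within : ∀ i j → T (red (G ∪ H) i j) → Within (red G) (red H) i j
    red-within i j r with splitAt m i in eqᵢ | splitAt m j in eqⱼ
    ... | inj₁ a | inj₁ b = subst₂ (Within _ _) (splitAt⁻¹-↑ˡ eqᵢ) (splitAt⁻¹-↑ˡ eqⱼ) (left r)
    ... | inj₂ a | inj₂ b = subst₂ (Within _ _) (splitAt⁻¹-↑ʳ eqᵢ) (splitAt⁻¹-↑ʳ eqⱼ) (right r)
    ... | inj₁ _ | inj₂ _ = ⊥-elim r
    ... | inj₂ _ | inj₁ _ = ⊥-elim r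

    blue-within : ∀ i j → T (blue (G ∪ H) i j) → Within (blue G) (blue H) i j
    blue-within i j b with splitAt m i in eqᵢ | splitAt m j in eqⱼ
    ... | inj₁ a | inj₁ b′ = subst₂ (Within _ _) (splitAt⁻¹-↑ˡ eqᵢ) (splitAt⁻¹-↑ˡ eqⱼ) (left b)
    ... | inj₂ a | inj₂ b′ = subst₂ (Within _ _) (splitAt⁻¹-↑ʳ eqᵢ) (splitAt⁻¹-↑ʳ eqⱼ) (right b)
    ... | inj₁ _ | inj₂ _ = ⊥-elim b
    ... | inj₂ _ | inj₁ _ = ⊥-elim b

    edge-within : ∀ i j → T (edge (G ∪ H) i j) → Within (edge G) (edge H) i j
    edge-within i j e with Equivalence.to T-∨ e
    ... | inj₁ r with red-within i j r
    ...   | left r′  = left (Equivalence.from T-∨ (inj₁ r′))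
    ...   | right r′ = right (Equivalence.from T-∨ (inj₁ r′))
    edge-within i j e | inj₂ b with blue-within i j b
    ...   | left b′  = left (Equivalence.from T-∨ (inj₂ b′))
    ...   | right b′ = right (Equivalence.from T-∨ (inj₂ b′))

    module _ {k : ℕ} (c : Vec (Fin k) m) (d : Vec (Fin k) p) where

      private
        colourˡ : ∀ a → lookup (c ++ d) (a ↑ˡ p) ≡ lookup c a
        colourˡ = lookup-++ˡ c d
        colourʳ : ∀ a → lookup (c ++ d) (m ↑ʳ a) ≡ lookup d a
        colourʳ = lookup-++ʳ c d

      union-colouring : IsColouring (G ∪ H) (c ++ d) ⇔
        (IsColouring G c × IsColouring H d ×
         RedBlueCompatible G H (lookup c) (lookup d) × RedBlueCompatible H G (lookup d) (lookup c))
      union-colouring = mk⇔ restrict glue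
        where
        restrict : IsColouring (G ∪ H) (c ++ d) →
          IsColouring G c × IsColouring H d ×
          RedBlueCompatible G H (lookup c) (lookup d) × RedBlueCompatible H G (lookup d) (lookup c)
        restrict (proper , compatible) =
          (proper-pullback G (G ∪ H) (_↑ˡ p) colourˡ edgeˡ proper ,
           compatible-pullback G (G ∪ H) G (G ∪ H) (_↑ˡ p) colourˡ (_↑ˡ p) colourˡ redˡ blueˡ compatible) ,
          (proper-pullback H (G ∪ H) (m ↑ʳ_) colourʳ edgeʳ proper ,
           compatible-pullback H (G ∪ H) H (G ∪ H) (m ↑ʳ_) colourʳ (m ↑ʳ_) colourʳ redʳ blueʳ compatible) ,
          compatible-pullback G (G ∪ H) H (G ∪ H) (_↑ˡ p) colourˡ (m ↑ʳ_) colourʳ redˡ blueʳ compatible ,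
          compatible-pullback H (G ∪ H) G (G ∪ H) (m ↑ʳ_) colourʳ (_↑ˡ p) colourˡ redʳ blueˡ compatible
          where
          redˡ : ∀ a b → T (red G a b) → T (red (G ∪ H) (a ↑ˡ p) (b ↑ˡ p))
          redˡ a b = subst T (sym (red-↑ˡ a b))
          blueˡ : ∀ a b → T (blue G a b) → T (blue (G ∪ H) (a ↑ˡ p) (b ↑ˡ p))
          blueˡ a b = subst T (sym (blue-↑ˡ a b))
          edgeˡ : ∀ a b → T (edge G a b) → T (edge (G ∪ H) (a ↑ˡ p) (b ↑ˡ p))
          edgeˡ a b = subst T (sym (cong₂ _∨_ (red-↑ˡ a b) (blue-↑ˡ a b)))
          redʳ : ∀ a b → T (red H a b) → T (red (G ∪ H) (m ↑ʳ a) (m ↑ʳ b))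
          redʳ a b = subst T (sym (red-↑ʳ a b))
          blueʳ : ∀ a b → T (blue H a b) → T (blue (G ∪ H) (m ↑ʳ a) (m ↑ʳ b))
          blueʳ a b = subst T (sym (blue-↑ʳ a b))
          edgeʳ : ∀ a b → T (edge H a b) → T (edge (G ∪ H) (m ↑ʳ a) (m ↑ʳ b))
          edgeʳ a b = subst T (sym (cong₂ _∨_ (red-↑ʳ a b) (blue-↑ʳ a b)))

        glue : IsColouring G c × IsColouring H d ×
          RedBlueCompatible G H (lookup c) (lookup d) × RedBlueCompatible H G (lookup d) (lookup c) →
          IsColouring (G ∪ H) (c ++ d)
        glue ((properG , compatibleG) , (properH , compatibleH) , compatibleGH , compatibleHG) = proper , compatible
          where
          proper : Proper (G ∪ H) (lookup (c ++ d))
          proper u x e with edge-within u x e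
          ... | left {a} {b} e′  = λ eq → properG a b e′ (subst₂ _≡_ (colourˡ a) (colourˡ b) eq)
          ... | right {a} {b} e′ = λ eq → properH a b e′ (subst₂ _≡_ (colourʳ a) (colourʳ b) eq)

          compatible : RedBlueCompatible (G ∪ H) (G ∪ H) (lookup (c ++ d)) (lookup (c ++ d))
          compatible u x v y r b with red-within u x r | blue-within v y b
          ... | left {a} {a′} r′ | left {b} {b′} b″ = λ eq₁ eq₂ → compatibleG a a′ b b′ r′ b″
            (subst₂ _≡_ (colourˡ a) (colourˡ b) eq₁) (subst₂ _≡_ (colourˡ a′) (colourˡ b′) eq₂)
          ... | left {a} {a′} r′ | right {b} {b′} b″ = λ eq₁ eq₂ → compatibleGH a a′ b b′ r′ b″
            (subst₂ _≡_ (colourˡ a) (colourʳ b) eq₁) (subst₂ _≡_ (colourˡ a′) (colourʳ b′) eq₂)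
          ... | right {a} {a′} r′ | left {b} {b′} b″ = λ eq₁ eq₂ → compatibleHG a a′ b b′ r′ b″
            (subst₂ _≡_ (colourʳ a) (colourˡ b) eq₁) (subst₂ _≡_ (colourʳ a′) (colourˡ b′) eq₂)
          ... | right {a} {a′} r′ | right {b} {b′} b″ = λ eq₁ eq₂ → compatibleH a a′ b b′ r′ b″
            (subst₂ _≡_ (colourʳ a) (colourʳ b) eq₁) (subst₂ _≡_ (colourʳ a′) (colourʳ b′) eq₂)

  BlueHit : ∀ {n k} → ECGraph n → Vec (Fin k) n → Fin k → Fin k → Set
  BlueHit {n} G c α β = Σ (Fin n) λ v → Σ (Fin n) λ y → T (blue G v y) × lookup c v ≡ α × lookup c y ≡ β

  -- The colours α, β may be put on the ends of the red edge of K₂ʳ next to G coloured by c.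
  Admissible : ∀ {n k} → ECGraph n → Vec (Fin k) n → Fin k → Fin k → Set
  Admissible G c α β = ¬ (α ≡ β ⊎ BlueHit G c α β)

  K2r-colouring : ∀ {k} (α β : Fin k) → IsColouring K2r (α ∷ β ∷ []) ⇔ α ≢ β
  K2r-colouring α β = mk⇔ (λ (proper , _) → proper zero (suc zero) _) (λ α≢β → proper α≢β , λ _ _ _ _ _ ())
    where
    proper : α ≢ β → Proper K2r (lookup (α ∷ β ∷ []))
    proper α≢β zero       (suc zero) _ = α≢β
    proper α≢β (suc zero) zero       _ = λ β≡α → α≢β (sym β≡α)
    proper α≢β zero       zero       ()
    proper α≢β (suc zero) (suc zero) ()

  module _ {n k : ℕ} (G : ECGraph n) (c : Vec (Fin k) n) (α β : Fin k) where

    -- The red edge of K₂ʳ coloured (α, β) is compatible with the blue edges of G exactly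
    -- when no blue edge carries the colours α, β (in either order, as blue edges are symmetric).
    K2r-compatible : WellFormed G →
      RedBlueCompatible K2r G (lookup (α ∷ β ∷ [])) (lookup c) ⇔ (¬ BlueHit G c α β)
    K2r-compatible wf = mk⇔
      (λ compatible (v , y , b , cv≡α , cy≡β) → compatible zero (suc zero) v y _ b (sym cv≡α) (sym cy≡β))
      compatible
      where
      open WellFormed wf
      compatible : ¬ BlueHit G c α β → RedBlueCompatible K2r G (lookup (α ∷ β ∷ [])) (lookup c)
      compatible no-hit zero (suc zero) v y _ b α≡cv β≡cy = no-hit (v , y , b , sym α≡cv , sym β≡cy)
      compatible no-hit (suc zero) zero v y _ b β≡cv α≡cy =
        no-hit (y , v , subst T (blue-sym v y) b , sym α≡cy , sym β≡cv)
      compatible no-hit zero       zero       _ _ ()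
      compatible no-hit (suc zero) (suc zero) _ _ ()

    union-K2r-colouring : WellFormed G →
      IsColouring (G ∪ K2r) (c ++ (α ∷ β ∷ [])) ⇔ (IsColouring G c × Admissible G c α β)
    union-K2r-colouring wf = mk⇔
      (λ colouring → let (colG , colK , _ , compatible) = to colouring in
        colG , λ { (inj₁ α≡β) → Equivalence.to (K2r-colouring α β) colK α≡β
                 ; (inj₂ hit) → Equivalence.to (K2r-compatible wf) compatible hit })
      (λ (colG , admissible) → from (colG , Equivalence.from (K2r-colouring α β) (λ α≡β → admissible (inj₁ α≡β)) ,
        (λ _ _ _ _ _ ()) , Equivalence.from (K2r-compatible wf) (λ hit → admissible (inj₂ hit))))
      where open Equivalence (union-colouring G K2r c (α ∷ β ∷ []))

module Counting where

  open import Defs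
  open FiniteSums
  open import Data.Nat using (ℕ; zero; suc; _+_; _*_)
  open import Data.Nat.Properties using (+-identityʳ; *-identityʳ)
  open import Data.Fin using (Fin; zero; suc; _≟_)
  open import Data.Fin.Properties using (any?; all?; suc-injective)
  open import Data.Vec using (Vec; []; _∷_; lookup; _++_)
  open import Data.List using (List; []; _∷_; allFin; map)
  open import Data.Product using (Σ; _×_; _,_)
  open import Data.Integer using (ℤ; +_) renaming (_+_ to _+ℤ_; _*_ to _*ℤ_; _-_ to _-ℤ_)
  open import Data.Integer.Properties using (pos-+; pos-*)
  open import Data.Integer.Solver using (module +-*-Solver)
  open import Data.Empty using (⊥-elim)
  open import Function using (_∘_)
  open import Function.Definitions using (Injective)
  open import Relation.Binary.PropositionalEquality
  open import Relation.Nullary using (¬_; Dec; yes; no)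
  open import Relation.Nullary.Decidable using (map′; _→-dec_; ¬?; _×-dec_)
  open import Relation.Unary using (Decidable)

  ∑-allVecs-suc : ∀ n k (f : Vec (Fin k) (suc n) → ℕ) →
    sumOver (allVecs (suc n) k) f ≡ ∑[ a ← allFin k ] ∑[ v ← allVecs n k ] f (a ∷ v)
  ∑-allVecs-suc n k f = trans (∑-concatMap (allFin k) (λ a → map (a ∷_) (allVecs n k)) f)
    (∑-cong (allFin k) (λ a → ∑-map (allVecs n k) (a ∷_) f))

  ∑-allVecs-++ : ∀ m p k (f : Vec (Fin k) (m + p) → ℕ) →
    sumOver (allVecs (m + p) k) f ≡ ∑[ c ← allVecs m k ] ∑[ d ← allVecs p k ] f (c ++ d)
  ∑-allVecs-++ zero    p k f = sym (+-identityʳ _)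
  ∑-allVecs-++ (suc m) p k f = begin
    sumOver (allVecs (suc m + p) k) f                                       ≡⟨ ∑-allVecs-suc (m + p) k f ⟩
    ∑[ a ← allFin k ] ∑[ v ← allVecs (m + p) k ] f (a ∷ v)
      ≡⟨ ∑-cong (allFin k) (λ a → ∑-allVecs-++ m p k (λ v → f (a ∷ v))) ⟩
    ∑[ a ← allFin k ] ∑[ c ← allVecs m k ] ∑[ d ← allVecs p k ] f (a ∷ c ++ d)
      ≡⟨ sym (∑-allVecs-suc m k (λ c → ∑[ d ← allVecs p k ] f (c ++ d))) ⟩
    ∑[ c ← allVecs (suc m) k ] ∑[ d ← allVecs p k ] f (c ++ d)             ∎
    where open ≡-Reasoning

  ∑-allVecs-2 : ∀ k (f : Vec (Fin k) 2 → ℕ) →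
    sumOver (allVecs 2 k) f ≡ ∑[ α ← allFin k ] ∑[ β ← allFin k ] f (α ∷ β ∷ [])
  ∑-allVecs-2 k f = trans (∑-allVecs-suc 1 k f) (∑-cong (allFin k) (λ α →
    trans (∑-allVecs-suc 0 k (λ v → f (α ∷ v))) (∑-cong (allFin k) (λ β → +-identityʳ _))))

  ∑-𝟙-scale : ∀ {a p} {A : Set a} (L : List A) {P : A → Set p} (P? : Decidable P) (f : A → ℕ) (Z : ℤ) →
    (∀ x → P x → + f x ≡ Z) → + (∑[ x ← L ] (𝟙 (P? x) * f x)) ≡ + (∑[ x ← L ] 𝟙 (P? x)) *ℤ Z
  ∑-𝟙-scale []      P? f Z f≡Z = refl
  ∑-𝟙-scale (x ∷ L) P? f Z f≡Z with P? x
  ... | no _  = ∑-𝟙-scale L P? f Z f≡Z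
  ... | yes p = begin
    + (f x + 0 + rest)                 ≡⟨ pos-+ (f x + 0) rest ⟩
    + (f x + 0) +ℤ + rest              ≡⟨ cong₂ _+ℤ_ (trans (cong +_ (+-identityʳ (f x))) (f≡Z x p)) (∑-𝟙-scale L P? f Z f≡Z) ⟩
    Z +ℤ + count *ℤ Z                  ≡⟨ solve 2 (λ z s → z :+ s :* z := (con (+ 1) :+ s) :* z) refl Z (+ count) ⟩
    (+ 1 +ℤ + count) *ℤ Z              ≡⟨ cong (_*ℤ Z) (sym (pos-+ 1 count)) ⟩
    + (1 + count) *ℤ Z                 ∎
    where
    open ≡-Reasoning
    open +-*-Solver
    rest count : ℕ
    rest  = ∑[ x ← L ] (𝟙 (P? x) * f x)
    count = ∑[ x ← L ] 𝟙 (P? x)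

  ℕ-sum⇒ℤ-difference : ∀ s n k → s + n ≡ k → + s ≡ + k -ℤ + n
  ℕ-sum⇒ℤ-difference s n k s+n≡k = begin
    + s                   ≡⟨ solve 2 (λ a b → a := a :+ b :- b) refl (+ s) (+ n) ⟩
    + s +ℤ + n -ℤ + n     ≡⟨ cong (_-ℤ + n) (trans (sym (pos-+ s n)) (cong +_ s+n≡k)) ⟩
    + k -ℤ + n            ∎
    where
    open ≡-Reasoning
    open +-*-Solver

  module _ {k : ℕ} where

    injective? : ∀ {n} (c : Vec (Fin k) n) → Dec (Injective _≡_ _≡_ (lookup c))
    injective? c = map′ (λ h {i} {j} → h i j) (λ h i j → h)
      (all? (λ i → all? (λ j → (lookup c i ≟ lookup c j) →-dec (i ≟ j))))

    Unused : ∀ {n} → Fin k → Vec (Fin k) n → Set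
    Unused {n} a v = ¬ (Σ (Fin n) λ i → lookup v i ≡ a)

    unused? : ∀ {n} (a : Fin k) (v : Vec (Fin k) n) → Dec (Unused a v)
    unused? a v = ¬? (any? (λ i → lookup v i ≟ a))

    injective-∷ : ∀ {n} (a : Fin k) (v : Vec (Fin k) n) →
      Injective _≡_ _≡_ (lookup (a ∷ v)) → Injective _≡_ _≡_ (lookup v) × Unused a v
    injective-∷ a v a∷v-inj = (λ e → suc-injective (a∷v-inj e)) , λ (i , vi≡a) → suc≢zero (a∷v-inj vi≡a)
      where
      suc≢zero : ∀ {n} {i : Fin n} → suc i ≢ zero
      suc≢zero ()

    ∷-injective : ∀ {n} (a : Fin k) (v : Vec (Fin k) n) →
      Injective _≡_ _≡_ (lookup v) → Unused a v → Injective _≡_ _≡_ (lookup (a ∷ v))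
    ∷-injective a v v-inj a-unused {zero}  {zero}  _     = refl
    ∷-injective a v v-inj a-unused {zero}  {suc j} a≡vj = ⊥-elim (a-unused (j , sym a≡vj))
    ∷-injective a v v-inj a-unused {suc i} {zero}  vi≡a = ⊥-elim (a-unused (i , vi≡a))
    ∷-injective a v v-inj a-unused {suc i} {suc j} e    = cong suc (v-inj e)

    count-unused : ∀ {n} (v : Vec (Fin k) n) → Injective _≡_ _≡_ (lookup v) →
      (∑[ a ← allFin k ] 𝟙 (unused? a v)) + n ≡ k
    count-unused {n} v v-inj = begin
      (∑[ a ← allFin k ] 𝟙 (unused? a v)) + n                              ≡⟨ cong₂ _+_ refl (sym count-used) ⟩
      (∑[ a ← allFin k ] 𝟙 (unused? a v)) + (∑[ a ← allFin k ] 𝟙 (used? a)) ≡⟨ sym (∑-+ (allFin k) _ _) ⟩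
      ∑[ a ← allFin k ] (𝟙 (unused? a v) + 𝟙 (used? a))                    ≡⟨ ∑-cong (allFin k) (λ a → 𝟙-¬ (used? a)) ⟩
      ∑[ a ← allFin k ] 1                                                   ≡⟨ trans (∑-allFin-const k 1) (*-identityʳ k) ⟩
      k                                                                     ∎
      where
      open ≡-Reasoning
      used? : ∀ a → Dec (Σ (Fin n) λ i → lookup v i ≡ a)
      used? a = any? (λ i → lookup v i ≟ a)
      count-used : ∑[ a ← allFin k ] 𝟙 (used? a) ≡ n
      count-used = trans
        (∑-reindex n k (lookup v) v-inj (λ a → 𝟙 (used? a)) (λ _ → 1)
          (λ i → 𝟙-yes (used? (lookup v i)) (i , refl)) (λ a a∉v → 𝟙-no (used? a) (λ (i , e) → a∉v i e)))
        (trans (∑-allFin-const n 1) (*-identityʳ n))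

  count-injective : ∀ n k → + (∑[ c ← allVecs n k ] 𝟙 (injective? c)) ≡ falling (+ k) n
  count-injective zero    k = cong +_ (cong (_+ 0) (𝟙-yes (injective? {k} []) λ { {()} }))
  count-injective (suc n) k = begin
    + (sumOver (allVecs (suc n) k) (𝟙 ∘ injective?))                              ≡⟨ cong +_ (∑-allVecs-suc n k _) ⟩
    + (∑[ a ← allFin k ] ∑[ v ← allVecs n k ] 𝟙 (injective? (a ∷ v)))
      ≡⟨ cong +_ (∑-cong (allFin k) (λ a → ∑-cong (allVecs n k) (λ v → split a v))) ⟩
    + (∑[ a ← allFin k ] ∑[ v ← allVecs n k ] (𝟙 (injective? v) * 𝟙 (unused? a v))) ≡⟨ cong +_ (∑-swap (allFin k) (allVecs n k) _) ⟩
    + (∑[ v ← allVecs n k ] ∑[ a ← allFin k ] (𝟙 (injective? v) * 𝟙 (unused? a v)))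
      ≡⟨ cong +_ (∑-cong (allVecs n k) (λ v → ∑-*ˡ (allFin k) (𝟙 (injective? v)) _)) ⟩
    + (∑[ v ← allVecs n k ] (𝟙 (injective? v) * ∑[ a ← allFin k ] 𝟙 (unused? a v)))
      ≡⟨ ∑-𝟙-scale (allVecs n k) injective? _ (+ k -ℤ + n) (λ v v-inj → ℕ-sum⇒ℤ-difference _ n k (count-unused v v-inj)) ⟩
    + (∑[ v ← allVecs n k ] 𝟙 (injective? v)) *ℤ (+ k -ℤ + n)                    ≡⟨ cong (_*ℤ (+ k -ℤ + n)) (count-injective n k) ⟩
    falling (+ k) n *ℤ (+ k -ℤ + n)                                               ∎
    where
    open ≡-Reasoning
    split : ∀ a (v : Vec (Fin k) n) → 𝟙 (injective? (a ∷ v)) ≡ 𝟙 (injective? v) * 𝟙 (unused? a v)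
    split a v = trans (𝟙-cong (injective? (a ∷ v)) (injective? v ×-dec unused? a v)
      (injective-∷ a v) (λ (v-inj , a-unused) → ∷-injective a v v-inj a-unused)) (𝟙-× (injective? v) (unused? a v))

  ℕ-identity⇒ℤ : ∀ e k b → e + (k + (b + b)) ≡ k * k → + e ≡ + k *ℤ + k -ℤ + k -ℤ + 2 *ℤ + b
  ℕ-identity⇒ℤ e k b identity = begin
    + e                                       ≡⟨ ℕ-sum⇒ℤ-difference e (k + (b + b)) (k * k) identity ⟩
    + (k * k) -ℤ + (k + (b + b))              ≡⟨ cong₂ _-ℤ_ (pos-* k k) (trans (pos-+ k (b + b)) (cong (+ k +ℤ_) (pos-+ b b))) ⟩
    + k *ℤ + k -ℤ (+ k +ℤ (+ b +ℤ + b))       ≡⟨ solve 2 (λ k b → k :* k :- (k :+ (b :+ b)) := k :* k :- k :- con (+ 2) :* b) refl (+ k) (+ b) ⟩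
    + k *ℤ + k -ℤ + k -ℤ + 2 *ℤ + b           ∎
    where
    open ≡-Reasoning
    open +-*-Solver

module ExtensionsByK2r where

  open import Defs
  open FiniteSums
  open Counting
  open DisjointUnion
  open import Data.Bool using (T)
  open import Data.Bool.Properties using (T?)
  open import Data.Nat using (ℕ; _+_; _*_; _<_; _<?_)
  open import Data.Nat.Properties using (*-identityʳ; <-asym; <-cmp)
  open import Data.Fin using (Fin; _≟_; toℕ)
  open import Data.Fin.Properties using (any?; toℕ-injective)
  open import Data.Vec using (Vec; []; _∷_; lookup; _++_)
  open import Data.List using (allFin; cartesianProduct)
  open import Data.Sum using (_⊎_; inj₁; inj₂)
  open import Data.Empty using (⊥-elim)
  open import Data.Product using (Σ; _×_; _,_)
  open import Function.Bundles using (Equivalence)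
  open import Function.Definitions using (Injective)
  open import Relation.Binary using (tri<; tri≈; tri>)
  open import Relation.Binary.PropositionalEquality
  open import Relation.Nullary using (¬_; Dec)
  open import Relation.Nullary.Decidable using (¬?; _×-dec_; _⊎-dec_)

  module _ {n : ℕ} (G : ECGraph n) (wf : WellFormed G) where
    open WellFormed wf

    ordered-blue-pairs : ∑[ v ← allFin n ] ∑[ y ← allFin n ] 𝟙 (T? (blue G v y)) ≡ numBlue G + numBlue G
    ordered-blue-pairs = begin
      ∑[ v ← allFin n ] ∑[ y ← allFin n ] 𝟙 (T? (blue G v y))
        ≡⟨ ∑-cong (allFin n) (λ v → ∑-cong (allFin n) (λ y → 𝟙-split (T? (blue G v y)) (toℕ v <? toℕ y) (toℕ y <? toℕ v)
             (λ (v<y , y<v) → <-asym v<y y<v) (ordered v y))) ⟩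
      ∑[ v ← allFin n ] ∑[ y ← allFin n ] (𝟙 (up v y) + 𝟙 (down v y))
        ≡⟨ trans (∑-cong (allFin n) (λ v → ∑-+ (allFin n) _ _)) (∑-+ (allFin n) _ _) ⟩
      (∑[ v ← allFin n ] ∑[ y ← allFin n ] 𝟙 (up v y)) + (∑[ v ← allFin n ] ∑[ y ← allFin n ] 𝟙 (down v y))
        ≡⟨ cong₂ _+_ refl (trans (∑-swap (allFin n) (allFin n) _) (∑-cong (allFin n) (λ y → ∑-cong (allFin n) (λ v → flip v y)))) ⟩
      (∑[ v ← allFin n ] ∑[ y ← allFin n ] 𝟙 (up v y)) + (∑[ y ← allFin n ] ∑[ v ← allFin n ] 𝟙 (up y v))
        ≡⟨ cong₂ _+_ (sym numBlue-as-sum) (sym numBlue-as-sum) ⟩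
      numBlue G + numBlue G ∎
      where
      open ≡-Reasoning
      up : ∀ v y → Dec ((toℕ v < toℕ y) × T (blue G v y))
      up v y = (toℕ v <? toℕ y) ×-dec T? (blue G v y)
      down : ∀ v y → Dec ((toℕ y < toℕ v) × T (blue G v y))
      down v y = (toℕ y <? toℕ v) ×-dec T? (blue G v y)
      numBlue-as-sum : numBlue G ≡ ∑[ v ← allFin n ] ∑[ y ← allFin n ] 𝟙 (up v y)
      numBlue-as-sum = trans (length-filter≡∑𝟙 _ (cartesianProduct (allFin n) (allFin n)))
                             (∑-cartesianProduct (allFin n) (allFin n) _)
      -- blue edges are loopless, so their ends are ordered one way or the other
      ordered : ∀ v y → T (blue G v y) → (toℕ v < toℕ y) ⊎ (toℕ y < toℕ v)
      ordered v y b with <-cmp (toℕ v) (toℕ y)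
      ... | tri< v<y _ _ = inj₁ v<y
      ... | tri> _ _ y<v = inj₂ y<v
      ... | tri≈ _ v≡y _ with toℕ-injective v≡y
      ...   | refl = ⊥-elim (subst T (blue-irr v) b)
      flip : ∀ v y → 𝟙 (down v y) ≡ 𝟙 (up y v)
      flip v y = 𝟙-cong (down v y) (up y v) (λ (y<v , b) → y<v , subst T (blue-sym v y) b)
                                            (λ (y<v , b) → y<v , subst T (blue-sym y v) b)

    module _ {k : ℕ} (c : Vec (Fin k) n) where

      blueHit? : ∀ α β → Dec (BlueHit G c α β)
      blueHit? α β = any? (λ v → any? (λ y → T? (blue G v y) ×-dec ((lookup c v ≟ α) ×-dec (lookup c y ≟ β))))

      admissible? : ∀ α β → Dec (Admissible G c α β)
      admissible? α β = ¬? ((α ≟ β) ⊎-dec blueHit? α β)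

      -- The number of ways to colour the ends of the added red edge, given c.
      admissible-pairs : ℕ
      admissible-pairs = ∑[ α ← allFin k ] ∑[ β ← allFin k ] 𝟙 (admissible? α β)

      module _ (c-inj : Injective _≡_ _≡_ (lookup c)) where

        count-blue-hits : ∑[ α ← allFin k ] ∑[ β ← allFin k ] 𝟙 (blueHit? α β)
                        ≡ ∑[ v ← allFin n ] ∑[ y ← allFin n ] 𝟙 (T? (blue G v y))
        count-blue-hits = begin
          ∑[ α ← allFin k ] ∑[ β ← allFin k ] 𝟙 (blueHit? α β)
            ≡⟨ ∑-reindex n k (lookup c) c-inj _ _ (λ v → ∑-cong (allFin k) (hit-at-image v))
                 (λ α α∉c → ∑-zero (allFin k) _ (hit-off-image α α∉c)) ⟩
          ∑[ v ← allFin n ] ∑[ β ← allFin k ] 𝟙 (hitFrom? v β)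
            ≡⟨ ∑-cong (allFin n) (λ v → ∑-reindex n k (lookup c) c-inj _ _ (hitFrom-at-image v) (hitFrom-off-image v)) ⟩
          ∑[ v ← allFin n ] ∑[ y ← allFin n ] 𝟙 (T? (blue G v y)) ∎
          where
          open ≡-Reasoning
          hitFrom? : ∀ v β → Dec (Σ (Fin n) λ y → T (blue G v y) × lookup c y ≡ β)
          hitFrom? v β = any? (λ y → T? (blue G v y) ×-dec (lookup c y ≟ β))

          -- as c is injective, a blue edge starting in colour c v starts at v
          hit-at-image : ∀ v β → 𝟙 (blueHit? (lookup c v) β) ≡ 𝟙 (hitFrom? v β)
          hit-at-image v β = 𝟙-cong (blueHit? (lookup c v) β) (hitFrom? v β)
            (λ (v′ , y , b , cv′≡cv , cy≡β) → y , subst (λ w → T (blue G w y)) (c-inj cv′≡cv) b , cy≡β)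
            (λ (y , b , cy≡β) → v , y , b , refl , cy≡β)

          hit-off-image : ∀ α → (∀ v → lookup c v ≢ α) → ∀ β → 𝟙 (blueHit? α β) ≡ 0
          hit-off-image α α∉c β = 𝟙-no (blueHit? α β) (λ (v , _ , _ , cv≡α , _) → α∉c v cv≡α)

          -- likewise a blue edge from v ending in colour c y ends at y
          hitFrom-at-image : ∀ v y → 𝟙 (hitFrom? v (lookup c y)) ≡ 𝟙 (T? (blue G v y))
          hitFrom-at-image v y = 𝟙-cong (hitFrom? v (lookup c y)) (T? (blue G v y))
            (λ (y′ , b , cy′≡cy) → subst (λ w → T (blue G v w)) (c-inj cy′≡cy) b) (λ b → y , b , refl)

          hitFrom-off-image : ∀ v β → (∀ y → lookup c y ≢ β) → 𝟙 (hitFrom? v β) ≡ 0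
          hitFrom-off-image v β β∉c = 𝟙-no (hitFrom? v β) (λ (y , _ , cy≡β) → β∉c y cy≡β)

        trichotomy : ∀ α β → 𝟙 (admissible? α β) + (𝟙 (α ≟ β) + 𝟙 (blueHit? α β)) ≡ 1
        trichotomy α β = trans (cong (𝟙 (admissible? α β) +_) (sym (𝟙-⊎ (α ≟ β) (blueHit? α β) repeated∧hit)))
                               (𝟙-¬ ((α ≟ β) ⊎-dec blueHit? α β))
          where
          repeated∧hit : ¬ (α ≡ β × BlueHit G c α β)
          repeated∧hit (refl , v , y , b , cv≡α , cy≡α) with c-inj (trans cv≡α (sym cy≡α))
          ... | refl = subst T (blue-irr v) b

        count-admissible : admissible-pairs + (k + (numBlue G + numBlue G)) ≡ k * k
        count-admissible = begin
          admissible-pairs + (k + (numBlue G + numBlue G))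
            ≡⟨ cong (admissible-pairs +_) (cong₂ _+_ (sym (∑-diagonal k)) (sym (trans count-blue-hits ordered-blue-pairs))) ⟩
          admissible-pairs + ((∑[ α ← allFin k ] ∑[ β ← allFin k ] 𝟙 (α ≟ β)) + (∑[ α ← allFin k ] ∑[ β ← allFin k ] 𝟙 (blueHit? α β)))
            ≡⟨ sym (trans (∑∑-+ _ _) (cong (admissible-pairs +_) (∑∑-+ _ _))) ⟩
          ∑[ α ← allFin k ] ∑[ β ← allFin k ] (𝟙 (admissible? α β) + (𝟙 (α ≟ β) + 𝟙 (blueHit? α β)))
            ≡⟨ ∑-cong (allFin k) (λ α → ∑-cong (allFin k) (trichotomy α)) ⟩
          ∑[ α ← allFin k ] ∑[ β ← allFin k ] 1
            ≡⟨ trans (∑-cong (allFin k) (λ _ → trans (∑-allFin-const k 1) (*-identityʳ k))) (∑-allFin-const k k) ⟩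
          k * k ∎
          where
          open ≡-Reasoning
          ∑∑-+ : ∀ (f g : Fin k → Fin k → ℕ) → ∑[ α ← allFin k ] ∑[ β ← allFin k ] (f α β + g α β)
            ≡ (∑[ α ← allFin k ] ∑[ β ← allFin k ] f α β) + (∑[ α ← allFin k ] ∑[ β ← allFin k ] g α β)
          ∑∑-+ f g = trans (∑-cong (allFin k) (λ α → ∑-+ (allFin k) (f α) (g α))) (∑-+ (allFin k) _ _)

    count-union-colourings : ∀ k →
      numColourings (G ∪ K2r) k ≡ ∑[ c ← allVecs n k ] (𝟙 (isColouring? G c) * admissible-pairs c)
    count-union-colourings k = begin
      numColourings (G ∪ K2r) k
        ≡⟨ length-filter≡∑𝟙 (isColouring? (G ∪ K2r)) (allVecs (n + 2) k) ⟩
      sumOver (allVecs (n + 2) k) (λ C → 𝟙 (isColouring? (G ∪ K2r) C))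
        ≡⟨ ∑-allVecs-++ n 2 k _ ⟩
      ∑[ c ← allVecs n k ] ∑[ d ← allVecs 2 k ] 𝟙 (isColouring? (G ∪ K2r) (c ++ d))
        ≡⟨ ∑-cong (allVecs n k) (λ c → ∑-allVecs-2 k _) ⟩
      ∑[ c ← allVecs n k ] ∑[ α ← allFin k ] ∑[ β ← allFin k ] 𝟙 (isColouring? (G ∪ K2r) (c ++ (α ∷ β ∷ [])))
        ≡⟨ ∑-cong (allVecs n k) (λ c → ∑-cong (allFin k) (λ α → ∑-cong (allFin k) (λ β → extension c α β))) ⟩
      ∑[ c ← allVecs n k ] ∑[ α ← allFin k ] ∑[ β ← allFin k ] (𝟙 (isColouring? G c) * 𝟙 (admissible? c α β))
        ≡⟨ ∑-cong (allVecs n k) (λ c → trans (∑-cong (allFin k) (λ α → ∑-*ˡ (allFin k) (𝟙 (isColouring? G c)) _))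
                                              (∑-*ˡ (allFin k) (𝟙 (isColouring? G c)) _)) ⟩
      ∑[ c ← allVecs n k ] (𝟙 (isColouring? G c) * admissible-pairs c) ∎
      where
      open ≡-Reasoning
      extension : ∀ c α β → 𝟙 (isColouring? (G ∪ K2r) (c ++ (α ∷ β ∷ [])))
                          ≡ 𝟙 (isColouring? G c) * 𝟙 (admissible? c α β)
      extension c α β = trans
        (𝟙-cong _ (isColouring? G c ×-dec admissible? c α β) to from)
        (𝟙-× (isColouring? G c) (admissible? c α β))
        where open Equivalence (union-K2r-colouring G c α β wf)

open import Defs
open FiniteSums
open Colourings
open Counting
open ExtensionsByK2r
open import Data.Nat using (ℕ)
import Data.Nat as ℕ
open import Data.Integer using (ℤ; +_; _-_; _*_)
open import Data.Fin using (Fin)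
open import Data.Vec using (Vec; lookup)
open import Function.Definitions using (Injective)
open import Relation.Binary.PropositionalEquality

-- Sum the k² - k - 2|B| extensions over the colourings of G, which are exactly the
-- injective colour vectors, of which there are k (k - 1) ⋯ (k - n + 1).
theorem14 : (n : ℕ) (G : ECGraph n) → WellFormed G → ChromaticNumberIs G n →
    (k : ℕ) → + numColourings (G ∪ K2r) k
    ≡ falling (+ k) n * (+ k * + k - + k - + 2 * + numBlue G)
theorem14 n G wf χ≡n k = begin
  + numColourings (G ∪ K2r) k
    ≡⟨ cong +_ (count-union-colourings G wf k) ⟩
  + (∑[ c ← allVecs n k ] (𝟙 (isColouring? G c) ℕ.* admissible-pairs G wf c))
    ≡⟨ ∑-𝟙-scale (allVecs n k) (isColouring? G) (admissible-pairs G wf) Z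
         (λ c col → ℕ-identity⇒ℤ _ k (numBlue G) (count-admissible G wf c (colouring-injective c col))) ⟩
  + (∑[ c ← allVecs n k ] 𝟙 (isColouring? G c)) * Z
    ≡⟨ cong (λ m → + m * Z) (∑-cong (allVecs n k) (λ c →
         𝟙-cong (isColouring? G c) (injective? c) (colouring-injective c) (injective⇒colouring G wf c))) ⟩
  + (∑[ c ← allVecs n k ] 𝟙 (injective? c)) * Z
    ≡⟨ cong (_* Z) (count-injective n k) ⟩
  falling (+ k) n * Z ∎
  where
  open ≡-Reasoning
  Z : ℤ
  Z = + k * + k - + k - + 2 * + numBlue G
  colouring-injective : ∀ (c : Vec (Fin k) n) → IsColouring G c → Injective _≡_ _≡_ (lookup c)
  colouring-injective = full-chromatic⇒injective G χ≡n
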